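{- Let $G$ be a connected graph with $\gamma_I^p(G)>2$. Then $\gamma_I^p(G)=3$ if and only if $G$ has a 2-fair dominating set of size $3$.
   Context: All graphs are finite, simple and undirected. For a graph $G=(V,E)$ and $v\in V$, $N(v)$ denotes the set of neighbours of $v$. A perfect Italian dominating function (PID-function) of $G$ is a function $f:V\to\{0,1,2\}$ such that for every vertex $v$ with $f(v)=0$ one has $\sum_{u\in N(v)} f(u)=2$. The weight of $f$ is $\sum_{v\in V} f(v)$; $\gamma_I^p(G)$ is the minimum weight of a PID-function of $G$. For $k\ge1$, a $k$-fair dominating set of $G$ is a dominating set $D\subseteq V$ such that $|N(v)\cap D|=k$ for every $v\in V\setminus D$. -}

module Defs where

open import Data.Nat using (ℕ; zero; suc; _+_; _≤_; _<_)
open import Data.Fin using (Fin; toℕ)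
open import Data.Bool using (Bool; true; false; if_then_else_; T)
open import Data.Product using (Σ; ∃; _×_; _,_)
open import Data.Vec.Functional using (foldr)
open import Relation.Binary.PropositionalEquality using (_≡_)
open import Relation.Nullary using (¬_)

record Graph : Set where
  field
    n    : ℕ
    adj  : Fin n → Fin n → Bool
    sym  : ∀ u v → adj u v ≡ adj v u
    irr  : ∀ v → adj v v ≡ false

open Graph public

Vertex : Graph → Set
Vertex G = Fin (n G)

sumV : (G : Graph) → (Vertex G → ℕ) → ℕ
sumV G f = foldr _+_ 0 f

Adj : (G : Graph) → Vertex G → Vertex G → Set
Adj G u v = T (adj G u v)

data Reach (G : Graph) : Vertex G → Vertex G → Set where
  here : ∀ {v} → Reach G v v
  step : ∀ {u w v} → Adj G u w → Reach G w v → Reach G u v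

Connected : Graph → Set
Connected G = ∀ u v → Reach G u v

nbSum : (G : Graph) → (Vertex G → ℕ) → Vertex G → ℕ
nbSum G f v = sumV G (λ u → if adj G v u then f u else 0)

Labelling : Graph → Set
Labelling G = Vertex G → Fin 3

val : {G : Graph} → Labelling G → Vertex G → ℕ
val f v = toℕ (f v)

weight : (G : Graph) → Labelling G → ℕ
weight G f = sumV G (val {G} f)

IsPID : (G : Graph) → Labelling G → Set
IsPID G f = ∀ v → val {G} f v ≡ 0 → nbSum G (val {G} f) v ≡ 2

PIDNumber : Graph → ℕ → Set
PIDNumber G k =
  (Σ (Labelling G) λ f → IsPID G f × weight G f ≡ k)
  × (∀ f → IsPID G f → k ≤ weight G f)

-- γ_I^p(G) > 2 (a minimum exists since the constant-1 function is a PID;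
-- stated as: every PID-function has weight > 2)
PIDNumberGreaterThan : Graph → ℕ → Set
PIDNumberGreaterThan G m = ∀ f → IsPID G f → m < weight G f

VSet : Graph → Set
VSet G = Vertex G → Bool

indicator : Bool → ℕ
indicator true = 1
indicator false = 0

card : (G : Graph) → VSet G → ℕ
card G D = sumV G (λ v → indicator (D v))

nbCount : (G : Graph) → VSet G → Vertex G → ℕ
nbCount G D v = sumV G (λ u → if adj G v u then indicator (D u) else 0)

IsDominating : (G : Graph) → VSet G → Set
IsDominating G D = ∀ v → D v ≡ false → ∃ λ u → Adj G v u × D u ≡ true

IsKFairDominating : ℕ → (G : Graph) → VSet G → Set
IsKFairDominating k G D =
  IsDominating G D × (∀ v → D v ≡ false → nbCount G D v ≡ k)

{-# OPTIONS --safe #-}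

-- A PID-function of weight 3 taking only the values 0 and 1 is the indicator of a 2-fair
-- dominating set of size 3, and conversely.  The value 2 cannot occur: otherwise f is 2 at
-- some a and 1 at a single other vertex b, and every further vertex, having neighbour sum 2,
-- is adjacent to a but not to b.  If b ~ a, then 2 at a alone is a PID-function of weight 2,
-- contradicting γ_I^p > 2; if not, b is isolated, contradicting connectivity.
module Submission where

open import Defs hiding (sym)
open import Algebra.Properties.CommutativeSemigroup as CSemigroup using ()
open import Algebra.Properties.CommutativeMonoid.Sum as Sum using ()
open import Data.Bool using (Bool; true; false; if_then_else_; T)
open import Data.Fin using (Fin; zero; suc; toℕ)
open import Data.Fin.Patterns using (0F; 1F; 2F)
open import Data.Fin.Properties using (_≟_)
open import Data.Nat using (ℕ; zero; suc; _+_; _<_)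
open import Data.Nat.Properties
  using ( +-0-commutativeMonoid; +-commutativeSemigroup; +-identityʳ; +-cancelˡ-≡
        ; m+n≡0⇒m≡0; m+n≡0⇒n≡0; suc-injective; <-irrefl)
open import Data.Product using (Σ; ∃; _×_; _,_; proj₁; proj₂)
open import Data.Unit using (tt)
open import Data.Vec.Functional using (Vector; updateAt; tail)
open import Data.Vec.Functional.Properties using (updateAt-updates; updateAt-minimal)
open import Function using (_∘_; const)
open import Function.Bundles using (_⇔_; mk⇔)
open import Relation.Binary.PropositionalEquality
  using (_≡_; _≢_; refl; sym; trans; cong; subst; module ≡-Reasoning)
open import Relation.Nullary using (yes; no; contradiction)

open Sum +-0-commutativeMonoid using (sum; sum-cong-≗; sum-replicate-zero)
open CSemigroup +-commutativeSemigroup using (x∙yz≈y∙xz)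

sum-zeros : ∀ {m} (h : Vector ℕ m) → (∀ i → h i ≡ 0) → sum h ≡ 0
sum-zeros {m} h h≗0 = trans (sum-cong-≗ h≗0) (sum-replicate-zero m)

sum≡0⇒zeros : ∀ {m} (h : Vector ℕ m) → sum h ≡ 0 → ∀ i → h i ≡ 0
sum≡0⇒zeros h eq zero    = m+n≡0⇒m≡0 (h zero) eq
sum≡0⇒zeros h eq (suc i) = sum≡0⇒zeros (tail h) (m+n≡0⇒n≡0 (h zero) eq) i

sum≢0⇒nonzero : ∀ {m} (h : Vector ℕ m) → sum h ≢ 0 → ∃ λ i → h i ≢ 0
sum≢0⇒nonzero {zero}  h ne = contradiction refl ne
sum≢0⇒nonzero {suc m} h ne with h zero in h₀
... | suc _ = zero , λ eq → contradiction (trans (sym h₀) eq) λ ()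
... | 0 with sum≢0⇒nonzero (tail h) ne
...   | i , hi≢0 = suc i , hi≢0

erase : ∀ {m} → Vector ℕ m → Fin m → Vector ℕ m
erase h a = updateAt h a (const 0)

erase-vanishes : ∀ {m} (h : Vector ℕ m) a i → (i ≢ a → h i ≡ 0) → erase h a i ≡ 0
erase-vanishes h a i vanishes with i ≟ a
... | yes refl = updateAt-updates a h
... | no i≢a   = trans (updateAt-minimal i a h i≢a) (vanishes i≢a)

sum-erase : ∀ {m} (h : Vector ℕ m) a → sum h ≡ h a + sum (erase h a)
sum-erase h zero    = refl
sum-erase h (suc a) = begin
  h zero + sum (tail h)                                ≡⟨ cong (h zero +_) (sum-erase (tail h) a) ⟩
  h zero + (h (suc a) + sum (erase (tail h) a))        ≡⟨ x∙yz≈y∙xz (h zero) (h (suc a)) _ ⟩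
  h (suc a) + (h zero + sum (erase (tail h) a))        ∎
  where open ≡-Reasoning

sum-single : ∀ {m} (h : Vector ℕ m) a → (∀ i → i ≢ a → h i ≡ 0) → sum h ≡ h a
sum-single h a rest = begin
  sum h                   ≡⟨ sum-erase h a ⟩
  h a + sum (erase h a)   ≡⟨ cong (h a +_) (sum-zeros (erase h a) λ i → erase-vanishes h a i (rest i)) ⟩
  h a + 0                 ≡⟨ +-identityʳ (h a) ⟩
  h a                     ∎
  where open ≡-Reasoning

sum-pair : ∀ {m} (h : Vector ℕ m) {a b} → a ≢ b → (∀ i → i ≢ a → i ≢ b → h i ≡ 0) →
           sum h ≡ h a + h b
sum-pair h {a} {b} a≢b rest = begin
  sum h                   ≡⟨ sum-erase h a ⟩
  h a + sum (erase h a)   ≡⟨ cong (h a +_) (sum-single (erase h a) b erased) ⟩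
  h a + erase h a b       ≡⟨ cong (h a +_) (updateAt-minimal b a h (a≢b ∘ sym)) ⟩
  h a + h b               ∎
  where
  open ≡-Reasoning
  erased : ∀ i → i ≢ b → erase h a i ≡ 0
  erased i i≢b = erase-vanishes h a i λ i≢a → rest i i≢a i≢b

sum≡1⇒single : ∀ {m} (h : Vector ℕ m) → sum h ≡ 1 → ∃ λ b → h b ≡ 1 × (∀ i → i ≢ b → h i ≡ 0)
sum≡1⇒single {suc m} h eq with h zero in h₀
... | 1 = zero , h₀ , λ where
  zero    0≢0 → contradiction refl 0≢0
  (suc i) _   → sum≡0⇒zeros (tail h) (suc-injective eq) i
... | 0 with sum≡1⇒single (tail h) eq
...   | b , hb≡1 , rest = suc b , hb≡1 , λ where
  zero    _   → h₀
  (suc i) i≢b → rest i (i≢b ∘ cong suc)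

sum≡at+1⇒pair : ∀ {m} (h : Vector ℕ m) a → sum h ≡ h a + 1 →
                ∃ λ b → b ≢ a × h b ≡ 1 × (∀ i → i ≢ a → i ≢ b → h i ≡ 0)
sum≡at+1⇒pair h a eq with sum≡1⇒single (erase h a) (+-cancelˡ-≡ (h a) _ _ (trans (sym (sum-erase h a)) eq))
... | b , hb≡1 , rest = b , b≢a , trans (sym (updateAt-minimal b a h b≢a)) hb≡1 ,
                        λ i i≢a i≢b → trans (sym (updateAt-minimal i a h i≢a)) (rest i i≢b)
  where
  b≢a : b ≢ a
  b≢a refl = contradiction (trans (sym (updateAt-updates a h)) hb≡1) λ ()

if-then-0 : ∀ c {x} → x ≡ 0 → (if c then x else 0) ≡ 0
if-then-0 true  x≡0 = x≡0
if-then-0 false _   = refl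

if-T : ∀ {c x} → T c → (if c then x else 0) ≡ x
if-T {true} _ = refl

if2+if1≡2 : ∀ c d {x y} → x ≡ 2 → y ≡ 1 → (if c then x else 0) + (if d then y else 0) ≡ 2 →
            c ≡ true × d ≡ false
if2+if1≡2 true  false refl refl refl = refl , refl
if2+if1≡2 true  true  refl refl ()
if2+if1≡2 false true  refl refl ()
if2+if1≡2 false false refl refl ()

if-indicator≢0 : ∀ c d → (if c then indicator d else 0) ≢ 0 → T c × d ≡ true
if-indicator≢0 true  true  _  = tt , refl
if-indicator≢0 true  false ne = contradiction refl ne
if-indicator≢0 false _     ne = contradiction refl ne

indicator≡0⇒false : ∀ {b} → indicator b ≡ 0 → b ≡ false
indicator≡0⇒false {false} _ = refl

isNonzero : Fin 3 → Bool
isNonzero 0F      = false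
isNonzero (suc _) = true

toℕ≡indicator-isNonzero : ∀ x → toℕ x ≢ 2 → toℕ x ≡ indicator (isNonzero x)
toℕ≡indicator-isNonzero 0F x≢2 = refl
toℕ≡indicator-isNonzero 1F x≢2 = refl
toℕ≡indicator-isNonzero 2F x≢2 = contradiction refl x≢2

indicatorLabel : Bool → Fin 3
indicatorLabel true  = 1F
indicatorLabel false = 0F

toℕ-indicatorLabel : ∀ b → toℕ (indicatorLabel b) ≡ indicator b
toℕ-indicatorLabel true  = refl
toℕ-indicatorLabel false = refl

module _ (G : Graph) where

  nbSum-single : ∀ (k : Vertex G → ℕ) a → (∀ i → i ≢ a → k i ≡ 0) →
                 ∀ v → nbSum G k v ≡ (if adj G v a then k a else 0)
  nbSum-single k a rest v = sum-single _ a λ i i≢a → if-then-0 (adj G v i) (rest i i≢a)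

  nbSum-pair : ∀ (k : Vertex G → ℕ) {a b} → a ≢ b → (∀ i → i ≢ a → i ≢ b → k i ≡ 0) →
               ∀ v → nbSum G k v ≡ (if adj G v a then k a else 0) + (if adj G v b then k b else 0)
  nbSum-pair k a≢b rest v = sum-pair _ a≢b λ i i≢a i≢b → if-then-0 (adj G v i) (rest i i≢a i≢b)

  nbCount≢0⇒neighbour : ∀ (D : VSet G) v → nbCount G D v ≢ 0 → ∃ λ u → T (adj G v u) × D u ≡ true
  nbCount≢0⇒neighbour D v ne with sum≢0⇒nonzero _ ne
  ... | u , term≢0 = u , if-indicator≢0 (adj G v u) (D u) term≢0

  Reach⇒neighbour : ∀ {u v} → Reach G u v → u ≢ v → ∃ (Adj G u)
  Reach⇒neighbour here           u≢u = contradiction refl u≢u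
  Reach⇒neighbour (step u~w _) _   = _ , u~w

  star : Vertex G → Labelling G
  star a = updateAt (const 0F) a (const 2F)

  star-centre : ∀ a → val {G} (star a) a ≡ 2
  star-centre a = cong toℕ (updateAt-updates a (const 0F))

  star-leaf : ∀ {a} v → v ≢ a → val {G} (star a) v ≡ 0
  star-leaf {a} v v≢a = cong toℕ (updateAt-minimal v a (const 0F) v≢a)

  weight-star : ∀ a → weight G (star a) ≡ 2
  weight-star a = trans (sum-single _ a star-leaf) (star-centre a)

  universal⇒star-PID : ∀ a → (∀ v → v ≢ a → Adj G v a) → IsPID G (star a)
  universal⇒star-PID a universal v fv≡0 = begin
    nbSum G (val {G} (star a)) v                          ≡⟨ nbSum-single _ a star-leaf v ⟩
    (if adj G v a then val {G} (star a) a else 0)         ≡⟨ if-T (universal v v≢a) ⟩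
    val {G} (star a) a                                    ≡⟨ star-centre a ⟩
    2                                                     ∎
    where
    open ≡-Reasoning
    v≢a : v ≢ a
    v≢a refl = contradiction (trans (sym (star-centre a)) fv≡0) λ ()

  module _ {f : Labelling G} {D : VSet G} (f≗D : ∀ v → val {G} f v ≡ indicator (D v)) where

    weight≡card : weight G f ≡ card G D
    weight≡card = sum-cong-≗ f≗D

    nbSum≡nbCount : ∀ v → nbSum G (val {G} f) v ≡ nbCount G D v
    nbSum≡nbCount v = sum-cong-≗ λ u → cong (λ x → if adj G v u then x else 0) (f≗D u)

    PID⇒2-fair : IsPID G f → IsKFairDominating 2 G D
    PID⇒2-fair pid = dominating , fair
      where
      fair : ∀ v → D v ≡ false → nbCount G D v ≡ 2
      fair v Dv≡false = trans (sym (nbSum≡nbCount v)) (pid v (trans (f≗D v) (cong indicator Dv≡false)))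
      dominating : IsDominating G D
      dominating v Dv≡false = nbCount≢0⇒neighbour D v λ count≡0 →
        contradiction (trans (sym (fair v Dv≡false)) count≡0) λ ()

    2-fair⇒PID : IsKFairDominating 2 G D → IsPID G f
    2-fair⇒PID (_ , fair) v fv≡0 =
      trans (nbSum≡nbCount v) (fair v (indicator≡0⇒false (trans (sym (f≗D v)) fv≡0)))

  module _ {f : Labelling G} (pid : IsPID G f) {a b} (a≢b : a ≢ b)
           (fa≡2 : val {G} f a ≡ 2) (fb≡1 : val {G} f b ≡ 1)
           (rest : ∀ i → i ≢ a → i ≢ b → val {G} f i ≡ 0) where

    leaves-see-only-a : ∀ v → v ≢ a → v ≢ b → adj G v a ≡ true × adj G v b ≡ false
    leaves-see-only-a v v≢a v≢b =
      if2+if1≡2 (adj G v a) (adj G v b) fa≡2 fb≡1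
        (trans (sym (nbSum-pair (val {G} f) a≢b rest v)) (pid v (rest v v≢a v≢b)))

    b~a⇒star-PID : adj G b a ≡ true → IsPID G (star a)
    b~a⇒star-PID b~a = universal⇒star-PID a universal
      where
      universal : ∀ v → v ≢ a → Adj G v a
      universal v v≢a with v ≟ b
      ... | yes refl = subst T (sym b~a) tt
      ... | no v≢b   = subst T (sym (proj₁ (leaves-see-only-a v v≢a v≢b))) tt

    b≁a⇒b-isolated : adj G b a ≡ false → ∀ w → adj G b w ≡ false
    b≁a⇒b-isolated b≁a w with w ≟ a | w ≟ b
    ... | yes refl | _        = b≁a
    ... | no _     | yes refl = irr G b
    ... | no w≢a   | no w≢b   = trans (Graph.sym G b w) (proj₂ (leaves-see-only-a w w≢a w≢b))

  PID-weight-3⇒no-2 : Connected G → PIDNumberGreaterThan G 2 →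
                      ∀ f → IsPID G f → weight G f ≡ 3 → ∀ a → val {G} f a ≢ 2
  PID-weight-3⇒no-2 connected γ>2 f pid w≡3 a fa≡2
    with sum≡at+1⇒pair (val {G} f) a (trans w≡3 (cong (_+ 1) (sym fa≡2)))
  ... | b , b≢a , fb≡1 , rest with adj G b a in b~a
  ...   | true  = <-irrefl refl (subst (2 <_) (weight-star a)
                    (γ>2 (star a) (b~a⇒star-PID pid (b≢a ∘ sym) fa≡2 fb≡1 rest b~a)))
  ...   | false with Reach⇒neighbour (connected b a) b≢a
  ...     | w , b~w = subst T (b≁a⇒b-isolated pid (b≢a ∘ sym) fa≡2 fb≡1 rest b~a w) b~w

theorem13 : (G : Graph) → Connected G → PIDNumberGreaterThan G 2 →
    (PIDNumber G 3 ⇔ Σ (VSet G) (λ D → IsKFairDominating 2 G D × card G D ≡ 3))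
theorem13 G connected γ>2 = mk⇔ to from
  where
  to : PIDNumber G 3 → Σ (VSet G) (λ D → IsKFairDominating 2 G D × card G D ≡ 3)
  to ((f , pid , w≡3) , _) = isNonzero ∘ f , PID⇒2-fair G f≗D pid , trans (sym (weight≡card G f≗D)) w≡3
    where
    f≗D : ∀ v → val {G} f v ≡ indicator (isNonzero (f v))
    f≗D v = toℕ≡indicator-isNonzero (f v) (PID-weight-3⇒no-2 G connected γ>2 f pid w≡3 v)

  from : Σ (VSet G) (λ D → IsKFairDominating 2 G D × card G D ≡ 3) → PIDNumber G 3
  from (D , fair , card≡3) = (f , 2-fair⇒PID G f≗D fair , trans (weight≡card G f≗D) card≡3) , γ>2
    where
    f : Labelling G
    f = indicatorLabel ∘ D
    f≗D : ∀ v → val {G} f v ≡ indicator (D v)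
    f≗D v = toℕ-indicatorLabel (D v)
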